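{- Let $T$ be a caterpillar and let $m\ge 2$ be an integer. If $\Delta(T)=3$, then $\chi'_g(T;m,1)\le 4$.
   Context: A caterpillar is a finite tree $T$ in which there is a path $S$, called the spine, such that a vertex lies on $S$ if and only if its degree in $T$ is at least two; the spine is an induced subgraph of $T$. $\Delta(T)$ denotes the maximum degree of $T$. The $(m,1)$-edge coloring game on a finite simple graph $G$ with a set of colors $X$ is played alternately by two players, Maker and Breaker, with Maker playing first. On each turn Maker makes $m$ moves and Breaker makes one move; a move consists of coloring one uncolored edge of $G$ with a color from $X$ so that adjacent edges (edges sharing an endpoint) always receive distinct colors. Maker wins if eventually every edge is colored; Breaker wins if at some point the player who is to move cannot color any edge. The $(m,1)$-game chromatic index $\chi'_g(G;m,1)$ is the smallest nonnegative integer $k$ such that Maker has a winning strategy when $|X|=k$. -}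

module Defs where

open import Data.Nat using (ℕ; zero; suc; _+_; _∸_; _≤_)
open import Data.Fin using (Fin; toℕ; _≟_)
open import Data.List using (List; length; lookup; allFin; map)
open import Data.Nat.ListAction using (sum)
open import Data.List.Membership.Propositional using (_∈_)
open import Data.List.Relation.Unary.Unique.Propositional using (Unique)
open import Data.Maybe using (Maybe; just; nothing)
open import Data.Product using (Σ; ∃; _×_; _,_; proj₁; proj₂)
open import Data.Sum using (_⊎_)
open import Relation.Nullary using (¬_; yes; no)
open import Relation.Binary.PropositionalEquality using (_≡_; _≢_)
open import Function.Bundles using (_⇔_)

record Graph : Set where
  field
    n      : ℕ
    N      : ℕ
    ends   : Fin N → Fin n × Fin n
    loopless : ∀ e → proj₁ (ends e) ≢ proj₂ (ends e)
    simple : ∀ e f → (ends e ≡ ends f ⊎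
                      (proj₁ (ends e) ≡ proj₂ (ends f) × proj₂ (ends e) ≡ proj₁ (ends f)))
                   → e ≡ f

open Graph public

Incident : (G : Graph) → Fin (n G) → Fin (N G) → Set
Incident G v e = v ≡ proj₁ (ends G e) ⊎ v ≡ proj₂ (ends G e)

Adj : (G : Graph) → Fin (n G) → Fin (n G) → Set
Adj G u v = ∃ λ e → ends G e ≡ (u , v) ⊎ ends G e ≡ (v , u)

deg : (G : Graph) → Fin (n G) → ℕ
deg G v = sum (map ind (allFin (N G)))
  where
  ind : Fin (N G) → ℕ
  ind e with v ≟ proj₁ (ends G e) | v ≟ proj₂ (ends G e)
  ... | yes _ | _     = 1
  ... | no _  | yes _ = 1
  ... | no _  | no _  = 0

MaxDegree : Graph → ℕ → Set
MaxDegree G d = (∀ v → deg G v ≤ d) × (∃ λ v → deg G v ≡ d)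

data Walk (G : Graph) : Fin (n G) → Fin (n G) → Set where
  here : ∀ {u} → Walk G u u
  step : ∀ {u w v} → Adj G u w → Walk G w v → Walk G u v

Connected : Graph → Set
Connected G = ∀ u v → Walk G u v

IsTree : Graph → Set
IsTree G = (N G + 1 ≡ n G) × Connected G

IsInducedPath : (G : Graph) → List (Fin (n G)) → Set
IsInducedPath G S =
  Unique S ×
  (∀ (i j : Fin (length S)) →
     Adj G (lookup S i) (lookup S j) ⇔ (toℕ j ≡ suc (toℕ i) ⊎ toℕ i ≡ suc (toℕ j)))

IsCaterpillar : Graph → Set
IsCaterpillar G = IsTree G ×
  (∃ λ (S : List (Fin (n G))) → IsInducedPath G S × (∀ v → (v ∈ S) ⇔ (2 ≤ deg G v)))

Colouring : Graph → ℕ → Set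
Colouring G k = Fin (N G) → Maybe (Fin k)

AdjEdges : (G : Graph) → Fin (N G) → Fin (N G) → Set
AdjEdges G e f = e ≢ f × ∃ λ v → Incident G v e × Incident G v f

Complete : ∀ {G k} → Colouring G k → Set
Complete {G} c = ∀ e → ∃ λ x → c e ≡ just x

Legal : ∀ {G k} → Colouring G k → Fin (N G) → Fin k → Set
Legal {G} c e x = c e ≡ nothing × (∀ f → AdjEdges G e f → c f ≢ just x)

update : ∀ {G k} → Colouring G k → Fin (N G) → Fin k → Colouring G k
update c e x f with f ≟ e
... | yes _ = just x
... | no _  = c f

-- whose turn: Maker with (r+1) moves left in the current turn, or Breaker
data Phase : Set where
  makerTurn   : ℕ → Phase
  breakerTurn : Phase

afterMaker : ℕ → Phase
afterMaker zero    = breakerTurn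
afterMaker (suc r) = makerTurn r

-- Maker wins once every edge is coloured; Breaker wins if the player to move
-- cannot colour any edge (while some edge is uncoloured).
data MakerWins (G : Graph) (m k : ℕ) : Colouring G k → Phase → Set where
  done   : ∀ {c p} → Complete {G} c → MakerWins G m k c p
  mkMove : ∀ {c r} (e : Fin (N G)) (x : Fin k) → Legal {G} c e x →
           MakerWins G m k (update {G} c e x) (afterMaker r) →
           MakerWins G m k c (makerTurn r)
  bkMove : ∀ {c} →
           (∃ λ e → ∃ λ x → Legal {G} c e x) →
           (∀ e x → Legal {G} c e x → MakerWins G m k (update {G} c e x) (makerTurn (m ∸ 1))) →
           MakerWins G m k c breakerTurn

emptyColouring : ∀ {G k} → Colouring G k
emptyColouring _ = nothing

MakerWinsGame : Graph → ℕ → ℕ → Set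
MakerWinsGame G m k = MakerWins G m k (emptyColouring {G} {k}) (makerTurn (m ∸ 1))

GameChromaticIndexAtMost : Graph → ℕ → ℕ → Set
GameChromaticIndexAtMost G m b = ∃ λ k → k ≤ b × MakerWinsGame G m k

-- Call an edge pendant if it has an endpoint of degree at most one, and inner otherwise.
-- When Δ ≤ 3 a pendant edge has at most two neighbouring edges, and in a caterpillar every inner
-- edge has both ends on the spine, so no vertex carries three inner edges. Hence, among four
-- colours, an uncoloured inner edge can only be blocked if two coloured pendant edges touch it.
-- Maker ends each turn in a healthy position, where no coloured pendant edge touches an
-- uncoloured inner edge: he colours inner edges before pendant ones, and after Breaker colours a
-- pendant edge p he uses his m ≥ 2 moves on the at most two uncoloured inner neighbours of p,
-- each of which has p as its only coloured pendant neighbour and so still has a free colour.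
module Submission where

open import Defs

open import Data.Bool using (true; false; if_then_else_)
open import Data.Empty using (⊥; ⊥-elim)
open import Data.Fin using (Fin; toℕ; _≟_; zero; suc)
open import Data.Fin.Properties using (injective⇒≤; toℕ-injective; any?; all?; ¬∀⟶∃¬; pigeonhole; <⇒≢)
open import Data.List using (List; []; _∷_; length; allFin; map; filter; lookup)
open import Data.List.Properties using (map-cong)
open import Data.List.Membership.Propositional using (_∈_)
open import Data.List.Membership.Propositional.Properties using (∈-filter⁺; ∈-allFin)
open import Data.List.Relation.Unary.Any using (index; here; there)
open import Data.List.Relation.Unary.Any.Properties using (lookup-index)
open import Data.Maybe using (Maybe; just; nothing)
open import Data.Maybe.Properties using (just-injective) renaming (≡-dec to ≡-dec-Maybe)
open import Data.Nat using (ℕ; zero; suc; _∸_; _≤_; _<_; z≤n; s≤s)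
open import Data.Nat.ListAction using (sum)
open import Data.Nat.Properties
  using (≤-refl; ≤-pred; <-≤-trans; <⇒≱; ≰⇒>; _≤?_; n<1+n; +-mono-≤; +-mono-<-≤; +-mono-≤-<; m∸n≡0⇒m≤n)
open import Data.Product using (Σ; ∃; _×_; _,_; proj₁; proj₂)
open import Data.Sum using (_⊎_; inj₁; inj₂)
open import Data.Vec as Vec using (Vec; []; _∷_)
open import Data.Vec.Relation.Unary.All using (All; []; _∷_)
open import Data.Vec.Relation.Unary.All.Properties using (lookup⁺)
open import Data.Vec.Relation.Unary.AllPairs using ([]; _∷_)
open import Data.Vec.Relation.Unary.Unique.Propositional using (Unique)
open import Data.Vec.Relation.Unary.Unique.Propositional.Properties using (lookup-injective)
open import Function.Base using (_∘_)
open import Function.Bundles using (Equivalence; _⇔_)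
open import Function.Definitions using (Injective)
open import Relation.Binary.PropositionalEquality using (_≡_; _≢_; refl; sym; trans; cong; subst; subst₂)
open import Relation.Nullary using (¬_; Dec; yes; no; does)
open import Relation.Nullary.Decidable using (_⊎-dec_; _×-dec_; ¬?; map′)
open import Relation.Unary using (Pred; Decidable)

sum-indicator≡length-filter : ∀ {a p} {A : Set a} {P : Pred A p} (P? : Decidable P) (xs : List A) →
  sum (map (λ x → if does (P? x) then 1 else 0) xs) ≡ length (filter P? xs)
sum-indicator≡length-filter P? [] = refl
sum-indicator≡length-filter P? (x ∷ xs) with does (P? x)
... | true  = cong suc (sum-indicator≡length-filter P? xs)
... | false = sum-indicator≡length-filter P? xs

sum-map-mono : ∀ {a} {A : Set a} {g h : A → ℕ} → (∀ x → g x ≤ h x) →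
               ∀ xs → sum (map g xs) ≤ sum (map h xs)
sum-map-mono g≤h []       = z≤n
sum-map-mono g≤h (x ∷ xs) = +-mono-≤ (g≤h x) (sum-map-mono g≤h xs)

sum-map-strict : ∀ {a} {A : Set a} {g h : A → ℕ} → (∀ x → g x ≤ h x) → ∀ {x xs} → x ∈ xs → g x < h x →
                 sum (map g xs) < sum (map h xs)
sum-map-strict g≤h {xs = _ ∷ xs} (here refl) gx<hx = +-mono-<-≤ gx<hx (sum-map-mono g≤h xs)
sum-map-strict g≤h {xs = y ∷ _}  (there x∈xs) gx<hx = +-mono-≤-< (g≤h y) (sum-map-strict g≤h x∈xs gx<hx)

PathNeighbours : ℕ → ℕ → Set
PathNeighbours i j = j ≡ suc i ⊎ i ≡ suc j

three-path-neighbours-collide : ∀ {i a b c} → PathNeighbours i a → PathNeighbours i b → PathNeighbours i c →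
                                a ≡ b ⊎ a ≡ c ⊎ b ≡ c
three-path-neighbours-collide (inj₁ refl) (inj₁ refl) _           = inj₁ refl
three-path-neighbours-collide (inj₂ refl) (inj₂ refl) _           = inj₁ refl
three-path-neighbours-collide (inj₁ refl) (inj₂ refl) (inj₁ refl) = inj₂ (inj₁ refl)
three-path-neighbours-collide (inj₁ refl) (inj₂ refl) (inj₂ refl) = inj₂ (inj₂ refl)
three-path-neighbours-collide (inj₂ refl) (inj₁ refl) (inj₁ refl) = inj₂ (inj₂ refl)
three-path-neighbours-collide (inj₂ refl) (inj₁ refl) (inj₂ refl) = inj₂ (inj₁ refl)

module _ (G : Graph) where

  Vertex Edge : Set
  Vertex = Fin (n G)
  Edge   = Fin (N G)

  incident? : (v : Vertex) → Decidable (Incident G v)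
  incident? v e = v ≟ proj₁ (ends G e) ⊎-dec v ≟ proj₂ (ends G e)

  -- deg sums a where-bound indicator that cannot be named from outside Defs; unification recovers it.
  private
    deg-summand : (v : Vertex) → Σ (Edge → ℕ) λ h → deg G v ≡ sum (map h (allFin (N G)))
    deg-summand v = _ , refl

    deg-summand-indicator : ∀ v e → proj₁ (deg-summand v) e ≡ (if does (incident? v e) then 1 else 0)
    deg-summand-indicator v e with v ≟ proj₁ (ends G e) | v ≟ proj₂ (ends G e)
    ... | yes _ | _     = refl
    ... | no _  | yes _ = refl
    ... | no _  | no _  = refl

  deg≡length-incident : ∀ v → deg G v ≡ length (filter (incident? v) (allFin (N G)))
  deg≡length-incident v = trans (cong sum (map-cong (deg-summand-indicator v) (allFin (N G))))
                                (sum-indicator≡length-filter (incident? v) (allFin (N G)))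

  unique-incident≤deg : ∀ {k v} (es : Vec Edge k) → Unique es → All (Incident G v) es → k ≤ deg G v
  unique-incident≤deg {k} {v} es unique incident =
    subst (k ≤_) (sym (deg≡length-incident v)) (injective⇒≤ position-injective)
    where
    member : ∀ i → Vec.lookup es i ∈ filter (incident? v) (allFin (N G))
    member i = ∈-filter⁺ (incident? v) (∈-allFin _) (lookup⁺ incident i)
    position-injective : ∀ {i j} → index (member i) ≡ index (member j) → i ≡ j
    position-injective {i} {j} eq = lookup-injective unique i j
      (trans (lookup-index (member i))
        (trans (cong (lookup (filter (incident? v) (allFin (N G)))) eq) (sym (lookup-index (member j)))))

  adjEdges? : ∀ e f → Dec (AdjEdges G e f)
  adjEdges? e f = ¬? (e ≟ f) ×-dec any? (λ v → incident? v e ×-dec incident? v f)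

  adjEdges-sym : ∀ {e f} → AdjEdges G e f → AdjEdges G f e
  adjEdges-sym (e≢f , v , v∈e , v∈f) = (λ f≡e → e≢f (sym f≡e)) , v , v∈f , v∈e

  PendantAt : Edge → Vertex → Set
  PendantAt e u = Incident G u e × deg G u ≤ 1

  Pendant : Edge → Set
  Pendant e = ∃ (PendantAt e)

  Inner : Edge → Set
  Inner e = ¬ Pendant e

  pendant? : Decidable Pendant
  pendant? e with deg G (proj₁ (ends G e)) ≤? 1 | deg G (proj₂ (ends G e)) ≤? 1
  ... | yes leaf  | _         = yes (_ , inj₁ refl , leaf)
  ... | no _      | yes leaf  = yes (_ , inj₂ refl , leaf)
  ... | no ¬leaf₁ | no ¬leaf₂ = no λ { (_ , inj₁ refl , leaf) → ¬leaf₁ leaf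
                                     ; (_ , inj₂ refl , leaf) → ¬leaf₂ leaf }

  inner-endpoint-deg≥2 : ∀ {e w} → Inner e → Incident G w e → 2 ≤ deg G w
  inner-endpoint-deg≥2 {w = w} inner w∈e with deg G w ≤? 1
  ... | yes leaf = ⊥-elim (inner (w , w∈e , leaf))
  ... | no ¬leaf = ≰⇒> ¬leaf

  leaf-edge-unique : ∀ {e f u} → PendantAt e u → Incident G u f → f ≡ e
  leaf-edge-unique {e} {f} (u∈e , leaf) u∈f with f ≟ e
  ... | yes f≡e = f≡e
  ... | no f≢e  = ⊥-elim (<⇒≱ (s≤s leaf)
    (unique-incident≤deg (f ∷ e ∷ []) ((f≢e ∷ []) ∷ [] ∷ []) (u∈f ∷ u∈e ∷ [])))

  endpoint-other-than-unique : ∀ {e u w w′} → Incident G u e → Incident G w e → Incident G w′ e →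
                               w ≢ u → w′ ≢ u → w ≡ w′
  endpoint-other-than-unique _           (inj₁ refl) (inj₁ refl) _   _    = refl
  endpoint-other-than-unique _           (inj₂ refl) (inj₂ refl) _   _    = refl
  endpoint-other-than-unique (inj₁ refl) (inj₁ refl) (inj₂ refl) w≢u _    = ⊥-elim (w≢u refl)
  endpoint-other-than-unique (inj₂ refl) (inj₁ refl) (inj₂ refl) _   w′≢u = ⊥-elim (w′≢u refl)
  endpoint-other-than-unique (inj₁ refl) (inj₂ refl) (inj₁ refl) _   w′≢u = ⊥-elim (w′≢u refl)
  endpoint-other-than-unique (inj₂ refl) (inj₂ refl) (inj₁ refl) w≢u _    = ⊥-elim (w≢u refl)

  data NeighbourKind (s f : Edge) : Fin 3 → Set where
    pendant-neighbour : Pendant f → NeighbourKind s f zero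
    inner-at-first    : Inner f → Incident G (proj₁ (ends G s)) f → NeighbourKind s f (suc zero)
    inner-at-second   : Inner f → Incident G (proj₂ (ends G s)) f → NeighbourKind s f (suc (suc zero))

  neighbourKind : ∀ {s f} → AdjEdges G s f → ∃ (NeighbourKind s f)
  neighbourKind {f = f} (_ , _ , v∈s , v∈f) with pendant? f | v∈s
  ... | yes p     | _         = _ , pendant-neighbour p
  ... | no ¬p     | inj₁ refl = _ , inner-at-first ¬p v∈f
  ... | no ¬p     | inj₂ refl = _ , inner-at-second ¬p v∈f

  pendant-neighbour-meets-hub : ∀ {p u f} → PendantAt p u → AdjEdges G p f →
                                ∃ λ w → w ≢ u × Incident G w p × Incident G w f
  pendant-neighbour-meets-hub pu (p≢f , w , w∈p , w∈f) =
    w , (λ { refl → p≢f (sym (leaf-edge-unique pu w∈f)) }) , w∈p , w∈f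

  module _ (Δ≤3 : ∀ v → deg G v ≤ 3) where

    no-four-edges-at-vertex : ∀ {v a b c d} → a ≢ b → a ≢ c → a ≢ d → b ≢ c → b ≢ d → c ≢ d →
      Incident G v a → Incident G v b → Incident G v c → Incident G v d → ⊥
    no-four-edges-at-vertex {a = a} {b} {c} {d} a≢b a≢c a≢d b≢c b≢d c≢d v∈a v∈b v∈c v∈d =
      <⇒≱ (s≤s (Δ≤3 _)) (unique-incident≤deg (a ∷ b ∷ c ∷ d ∷ [])
        ((a≢b ∷ a≢c ∷ a≢d ∷ []) ∷ (b≢c ∷ b≢d ∷ []) ∷ (c≢d ∷ []) ∷ [] ∷ [])
        (v∈a ∷ v∈b ∷ v∈c ∷ v∈d ∷ []))

    pendant-no-three-neighbours : ∀ {p u a b c} → PendantAt p u →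
      AdjEdges G p a → AdjEdges G p b → AdjEdges G p c → a ≢ b → a ≢ c → b ≢ c → ⊥
    pendant-no-three-neighbours pu pa pb pc a≢b a≢c b≢c
      with pendant-neighbour-meets-hub pu pa | pendant-neighbour-meets-hub pu pb
         | pendant-neighbour-meets-hub pu pc
    ... | w , w≢u , w∈p , w∈a | w₁ , w₁≢u , w₁∈p , w∈b | w₂ , w₂≢u , w₂∈p , w∈c
      with endpoint-other-than-unique (proj₁ pu) w∈p w₁∈p w≢u w₁≢u
         | endpoint-other-than-unique (proj₁ pu) w∈p w₂∈p w≢u w₂≢u
    ... | refl | refl =
      no-four-edges-at-vertex (proj₁ pa) (proj₁ pb) (proj₁ pc) a≢b a≢c b≢c w∈p w∈a w∈b w∈c

    pendant-neighbours-besides : ∀ {p u s s₁ s₂} → PendantAt p u →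
      AdjEdges G p s₁ → AdjEdges G p s₂ → AdjEdges G p s → s₁ ≢ s → s₂ ≢ s → s₁ ≡ s₂
    pendant-neighbours-besides {s₁ = s₁} {s₂} pu ps₁ ps₂ ps s₁≢s s₂≢s with s₁ ≟ s₂
    ... | yes s₁≡s₂ = s₁≡s₂
    ... | no s₁≢s₂  = ⊥-elim (pendant-no-three-neighbours pu ps₁ ps₂ ps s₁≢s₂ s₁≢s s₂≢s)

  InnerClawFree : Set
  InnerClawFree = ∀ {v a b c} → a ≢ b → a ≢ c → b ≢ c →
    Incident G v a → Incident G v b → Incident G v c → Inner a → Inner b → Inner c → ⊥

  Joins : Edge → Vertex → Vertex → Set
  Joins e v w = ends G e ≡ (v , w) ⊎ ends G e ≡ (w , v)

  incident⇒joins : ∀ {v e} → Incident G v e → ∃ (Joins e v)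
  incident⇒joins {e = e} (inj₁ refl) = proj₂ (ends G e) , inj₁ refl
  incident⇒joins {e = e} (inj₂ refl) = proj₁ (ends G e) , inj₂ refl

  joins⇒incident : ∀ {e v w} → Joins e v w → Incident G w e
  joins⇒incident (inj₁ eq) = inj₂ (cong proj₂ (sym eq))
  joins⇒incident (inj₂ eq) = inj₁ (cong proj₁ (sym eq))

  private
    reversed-ends : ∀ {a b x y} → ends G a ≡ (x , y) → ends G b ≡ (y , x) →
                    proj₁ (ends G a) ≡ proj₂ (ends G b) × proj₂ (ends G a) ≡ proj₁ (ends G b)
    reversed-ends p q = trans (cong proj₁ p) (sym (cong proj₂ q)) , trans (cong proj₂ p) (sym (cong proj₁ q))

  joins-unique : ∀ {a b v w} → Joins a v w → Joins b v w → a ≡ b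
  joins-unique {a} {b} (inj₁ p) (inj₁ q) = simple G a b (inj₁ (trans p (sym q)))
  joins-unique {a} {b} (inj₂ p) (inj₂ q) = simple G a b (inj₁ (trans p (sym q)))
  joins-unique {a} {b} (inj₁ p) (inj₂ q) = simple G a b (inj₂ (reversed-ends p q))
  joins-unique {a} {b} (inj₂ p) (inj₁ q) = simple G a b (inj₂ (reversed-ends p q))

  module _ {S : List Vertex}
           (induced : ∀ i j → Adj G (lookup S i) (lookup S j) ⇔ PathNeighbours (toℕ i) (toℕ j))
           (spine-iff : ∀ v → (v ∈ S) ⇔ (2 ≤ deg G v)) where

    private
      position : ∀ {w} → w ∈ S → ℕ
      position w∈S = toℕ (index w∈S)

      inner-on-spine : ∀ {e w} → Inner e → Incident G w e → w ∈ S
      inner-on-spine inner w∈e = Equivalence.from (spine-iff _) (inner-endpoint-deg≥2 inner w∈e)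

      far-end : ∀ {v e} (v∈S : v ∈ S) → Inner e → Incident G v e →
                ∃ λ w → Joins e v w × Σ (w ∈ S) λ w∈S → PathNeighbours (position v∈S) (position w∈S)
      far-end {e = e} v∈S inner v∈e with incident⇒joins v∈e
      ... | w , j = w , j , w∈S , Equivalence.to (induced (index v∈S) (index w∈S))
                                    (subst₂ (Adj G) (lookup-index v∈S) (lookup-index w∈S) (e , j))
        where
        w∈S : w ∈ S
        w∈S = inner-on-spine inner (joins⇒incident j)

      same-far-end : ∀ {v a b w w′} → Joins a v w → Joins b v w′ → (w∈S : w ∈ S) (w′∈S : w′ ∈ S) →
                     position w∈S ≡ position w′∈S → a ≡ b
      same-far-end {v} {b = b} {w} {w′} ja jb w∈S w′∈S eq =
        joins-unique ja (subst (Joins b v) (sym w≡w′) jb)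
        where
        w≡w′ : w ≡ w′
        w≡w′ = trans (lookup-index w∈S)
                       (trans (cong (lookup S) (toℕ-injective eq)) (sym (lookup-index w′∈S)))

    induced-spine⇒innerClawFree : InnerClawFree
    induced-spine⇒innerClawFree a≢b a≢c b≢c v∈a v∈b v∈c inner-a inner-b inner-c
      with v∈S ← inner-on-spine inner-a v∈a
      with far-end v∈S inner-a v∈a | far-end v∈S inner-b v∈b | far-end v∈S inner-c v∈c
    ... | _ , ja , wa∈S , sa | _ , jb , wb∈S , sb | _ , jc , wc∈S , sc
      with three-path-neighbours-collide sa sb sc
    ... | inj₁ pa≡pb        = a≢b (same-far-end ja jb wa∈S wb∈S pa≡pb)
    ... | inj₂ (inj₁ pa≡pc) = a≢c (same-far-end ja jc wa∈S wc∈S pa≡pc)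
    ... | inj₂ (inj₂ pb≡pc) = b≢c (same-far-end jb jc wb∈S wc∈S pb≡pc)

  caterpillar⇒innerClawFree : IsCaterpillar G → InnerClawFree
  caterpillar⇒innerClawFree (_ , _ , (_ , induced) , spine-iff) = induced-spine⇒innerClawFree induced spine-iff

module _ {G : Graph} {k : ℕ} where

  Coloured : Colouring G k → Edge G → Set
  Coloured c e = ∃ λ x → c e ≡ just x

  HasUncoloured : Colouring G k → Set
  HasUncoloured c = ∃ λ e → c e ≡ nothing

  uncoloured? : (c : Colouring G k) → Decidable (λ e → c e ≡ nothing)
  uncoloured? c e = ≡-dec-Maybe _≟_ (c e) nothing

  hasUncoloured? : (c : Colouring G k) → Dec (HasUncoloured c)
  hasUncoloured? c = any? (uncoloured? c)

  coloured? : (c : Colouring G k) → Decidable (Coloured c)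
  coloured? c e with c e
  ... | just x  = yes (x , refl)
  ... | nothing = no λ ()

  ¬hasUncoloured⇒complete : ∀ {c} → ¬ HasUncoloured c → Complete {G} c
  ¬hasUncoloured⇒complete {c} none e with c e in eq
  ... | just x  = x , refl
  ... | nothing = ⊥-elim (none (e , eq))

  update-same : ∀ (c : Colouring G k) e x → update {G} c e x e ≡ just x
  update-same c e x with e ≟ e
  ... | yes _  = refl
  ... | no e≢e = ⊥-elim (e≢e refl)

  update-other : ∀ (c : Colouring G k) {e x f} → f ≢ e → update {G} c e x f ≡ c f
  update-other c {e} {f = f} f≢e with f ≟ e
  ... | yes f≡e = ⊥-elim (f≢e f≡e)
  ... | no _    = refl

  uncoloured-update : ∀ {c : Colouring G k} {e x f} → update {G} c e x f ≡ nothing → f ≢ e × c f ≡ nothing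
  uncoloured-update {c} {e} {x} {f} uncoloured = f≢e , trans (sym (update-other c f≢e)) uncoloured
    where
    f≢e : f ≢ e
    f≢e refl with () ← trans (sym uncoloured) (update-same c e x)

  coloured-update⁻ : ∀ {c : Colouring G k} {e x f} → f ≢ e → Coloured (update {G} c e x) f → Coloured c f
  coloured-update⁻ {c} f≢e (y , eq) = y , trans (sym (update-other c f≢e)) eq

  UsedAround : Colouring G k → Edge G → Fin k → Set
  UsedAround c e x = ∃ λ f → AdjEdges G e f × c f ≡ just x

  usedAround? : ∀ c e → Decidable (UsedAround c e)
  usedAround? c e x = any? λ f → adjEdges? G e f ×-dec ≡-dec-Maybe _≟_ (c f) (just x)

  free-colour : ∀ {c : Colouring G k} {e} → c e ≡ nothing →
    (∀ (f : Fin k → Edge G) → Injective _≡_ _≡_ f → (∀ i → AdjEdges G e (f i) × Coloured c (f i)) → ⊥) →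
    ∃ (Legal {G} c e)
  free-colour {c} {e} uncoloured fewer with all? (usedAround? c e)
  ... | yes used =
    ⊥-elim (fewer witness witness-injective λ i → proj₁ (proj₂ (used i)) , i , proj₂ (proj₂ (used i)))
    where
    witness : Fin k → Edge G
    witness i = proj₁ (used i)
    witness-injective : Injective _≡_ _≡_ witness
    witness-injective {i} {j} eq =
      just-injective (trans (sym (proj₂ (proj₂ (used i)))) (trans (cong c eq) (proj₂ (proj₂ (used j)))))
  ... | no ¬used with ¬∀⟶∃¬ k (UsedAround c e) (usedAround? c e) ¬used
  ...   | x , unused = x , uncoloured , λ f adjacent cf≡x → unused (f , adjacent , cf≡x)

  isUncoloured : Maybe (Fin k) → ℕ
  isUncoloured nothing  = 1
  isUncoloured (just _) = 0

  uncolouredCount : Colouring G k → ℕ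
  uncolouredCount c = sum (map (λ e → isUncoloured (c e)) (allFin (N G)))

  uncolouredCount-update : ∀ {c : Colouring G k} {e} x → c e ≡ nothing →
                           uncolouredCount (update {G} c e x) < uncolouredCount c
  uncolouredCount-update {c} {e} x uncoloured = sum-map-strict pointwise (∈-allFin e) at-e
    where
    pointwise : ∀ f → isUncoloured (update {G} c e x f) ≤ isUncoloured (c f)
    pointwise f with f ≟ e
    ... | yes _ = z≤n
    ... | no _  = ≤-refl
    at-e : isUncoloured (update {G} c e x e) < isUncoloured (c e)
    at-e rewrite update-same c e x | uncoloured = s≤s z≤n

module _ {G : Graph} {m k : ℕ} (Inv : Colouring G k → Phase → Set)
  (maker-move : ∀ {c r} → Inv c (makerTurn r) → HasUncoloured {G} c →
                ∃ λ e → ∃ λ x → Legal {G} c e x × Inv (update {G} c e x) (afterMaker r))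
  (breaker-can-move : ∀ {c} → Inv c breakerTurn → HasUncoloured {G} c → ∃ λ e → ∃ (Legal {G} c e))
  (breaker-cannot-break : ∀ {c e x} → Inv c breakerTurn → Legal {G} c e x →
                          Inv (update {G} c e x) (makerTurn (m ∸ 1)))
  where

  private
    shrink : ∀ {fuel} {c : Colouring G k} {e x} → Legal {G} c e x → uncolouredCount {G} c < suc fuel →
             uncolouredCount {G} (update {G} c e x) < fuel
    shrink {c = c} {x = x} legal bound =
      <-≤-trans (uncolouredCount-update {G = G} {c = c} x (proj₁ legal)) (≤-pred bound)

    wins : ∀ fuel {c} p → uncolouredCount {G} c < fuel → Inv c p → MakerWins G m k c p
    wins zero _ ()
    wins (suc fuel) {c} (makerTurn _) bound inv with hasUncoloured? {G} c
    ... | no none = done (¬hasUncoloured⇒complete {G} none)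
    ... | yes some with maker-move inv some
    ...   | e , x , legal , inv′ = mkMove e x legal (wins fuel _ (shrink legal bound) inv′)
    wins (suc fuel) {c} breakerTurn bound inv with hasUncoloured? {G} c
    ... | no none = done (¬hasUncoloured⇒complete {G} none)
    ... | yes some = bkMove (breaker-can-move inv some) λ e x legal →
      wins fuel _ (shrink legal bound) (breaker-cannot-break inv legal)

  invariant⇒makerWins : ∀ {c p} → Inv c p → MakerWins G m k c p
  invariant⇒makerWins {c} {p} = wins (suc (uncolouredCount {G} c)) p (n<1+n _)

module _ {G : Graph} (Δ≤3 : ∀ v → deg G v ≤ 3) (claw-free : InnerClawFree G) where

  record Defect (c : Colouring G 4) (q s : Edge G) : Set where
    field
      pendant    : Pendant G q
      coloured   : Coloured {G} c q
      inner      : Inner G s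
      uncoloured : c s ≡ nothing
      adjacent   : AdjEdges G q s

  open Defect

  pendant-colourable : ∀ {c : Colouring G 4} {q u} → PendantAt G q u → c q ≡ nothing → ∃ (Legal {G} c q)
  pendant-colourable pu uncoloured = free-colour {G} uncoloured λ f injective around →
    let distinct : ∀ {i j} → i ≢ j → f i ≢ f j
        distinct i≢j = i≢j ∘ injective
    in pendant-no-three-neighbours G Δ≤3 pu (proj₁ (around zero)) (proj₁ (around (suc zero)))
         (proj₁ (around (suc (suc zero)))) (distinct λ ()) (distinct λ ()) (distinct λ ())

  distinct-neighbours-differ-in-kind : ∀ {c : Colouring G 4} {s f g κ} → Inner G s → c s ≡ nothing →
    (∀ {q q′} → Defect c q s → Defect c q′ s → q ≡ q′) →
    AdjEdges G s f × Coloured {G} c f → AdjEdges G s g × Coloured {G} c g → f ≢ g →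
    NeighbourKind G s f κ → NeighbourKind G s g κ → ⊥
  distinct-neighbours-differ-in-kind {c} {s} inner-s uncoloured-s single-defect (sf , cf) (sg , cg) f≢g
    (pendant-neighbour pf) (pendant-neighbour pg) = f≢g (single-defect (defect pf cf sf) (defect pg cg sg))
    where
    defect : ∀ {q} → Pendant G q → Coloured {G} c q → AdjEdges G s q → Defect c q s
    defect p cq sq = record { pendant = p ; coloured = cq ; inner = inner-s
                            ; uncoloured = uncoloured-s ; adjacent = adjEdges-sym G sq }
  distinct-neighbours-differ-in-kind inner-s _ _ (sf , _) (sg , _) f≢g
    (inner-at-first if vf) (inner-at-first ig vg) =
    claw-free (proj₁ sf) (proj₁ sg) f≢g (inj₁ refl) vf vg inner-s if ig
  distinct-neighbours-differ-in-kind inner-s _ _ (sf , _) (sg , _) f≢g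
    (inner-at-second if vf) (inner-at-second ig vg) =
    claw-free (proj₁ sf) (proj₁ sg) f≢g (inj₂ refl) vf vg inner-s if ig

  inner-no-four-coloured-neighbours : ∀ {c : Colouring G 4} {s} → Inner G s → c s ≡ nothing →
    (∀ {q q′} → Defect c q s → Defect c q′ s → q ≡ q′) →
    ∀ (f : Fin 4 → Edge G) → Injective _≡_ _≡_ f → (∀ i → AdjEdges G s (f i) × Coloured {G} c (f i)) → ⊥
  inner-no-four-coloured-neighbours {s = s} inner-s uncoloured-s single-defect f injective around
    with i , j , i<j , same-kind ← pigeonhole (n<1+n 3) (λ i → proj₁ (neighbourKind G (proj₁ (around i))))
    = distinct-neighbours-differ-in-kind inner-s uncoloured-s single-defect (around i) (around j)
        (<⇒≢ i<j ∘ injective) (proj₂ (neighbourKind G (proj₁ (around i))))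
        (subst (NeighbourKind G s (f j)) (sym same-kind) (proj₂ (neighbourKind G (proj₁ (around j)))))

  inner-colourable : ∀ {c : Colouring G 4} {s} → Inner G s → c s ≡ nothing →
                     (∀ {q q′} → Defect c q s → Defect c q′ s → q ≡ q′) → ∃ (Legal {G} c s)
  inner-colourable inner-s uncoloured-s single-defect =
    free-colour {G} uncoloured-s (inner-no-four-coloured-neighbours inner-s uncoloured-s single-defect)

  defect? : (c : Colouring G 4) → Dec (∃ λ q → ∃ (Defect c q))
  defect? c = any? λ q → any? λ s →
    map′ (λ (p , cq , i , us , a) →
            record { pendant = p ; coloured = cq ; inner = i ; uncoloured = us ; adjacent = a })
         (λ d → pendant d , coloured d , inner d , uncoloured d , adjacent d)
         (pendant? G q ×-dec coloured? {G} c q ×-dec ¬? (pendant? G s) ×-dec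
          uncoloured? {G} c s ×-dec adjEdges? G q s)

  defect-update : ∀ {c : Colouring G 4} {e x q s} → Defect (update {G} c e x) q s →
                  s ≢ e × (q ≡ e ⊎ Defect c q s)
  defect-update {c} {e} {x} {q} d with uncoloured-update {G} {c = c} {e} {x} (uncoloured d) | q ≟ e
  ... | s≢e , _             | yes q≡e = s≢e , inj₁ q≡e
  ... | s≢e , uncoloured-cs | no q≢e  = s≢e , inj₂ (record
    { pendant = pendant d ; coloured = coloured-update⁻ {G} q≢e (coloured d) ; inner = inner d
    ; uncoloured = uncoloured-cs ; adjacent = adjacent d })

  defect-update-inner : ∀ {c : Colouring G 4} {e x q s} → Inner G e → Defect (update {G} c e x) q s →
                        s ≢ e × Defect c q s
  defect-update-inner inner-e d with defect-update d
  ... | _   , inj₁ refl = ⊥-elim (inner-e (pendant d))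
  ... | s≢e , inj₂ d′   = s≢e , d′

  Healthy : Colouring G 4 → Set
  Healthy c = ∀ {q s} → ¬ Defect c q s

  -- All defects hang off one pendant edge, and on Maker's last move of the turn there is only one.
  Repairable : Colouring G 4 → ℕ → Set
  Repairable c r = ∀ {q s q′ s′} → Defect c q s → Defect c q′ s′ → q ≡ q′ × (r ≡ 0 → s ≡ s′)

  StrategyInvariant : Colouring G 4 → Phase → Set
  StrategyInvariant c (makerTurn r) = Repairable c r
  StrategyInvariant c breakerTurn   = Healthy c

  healthy⇒invariant : ∀ {c} → Healthy c → ∀ p → StrategyInvariant c p
  healthy⇒invariant healthy (makerTurn _) d _ = ⊥-elim (healthy d)
  healthy⇒invariant healthy breakerTurn       = healthy

  healthy⇒colourable : ∀ {c : Colouring G 4} {e} → Healthy c → c e ≡ nothing → ∃ (Legal {G} c e)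
  healthy⇒colourable {e = e} healthy uncoloured with pendant? G e
  ... | yes (_ , pu) = pendant-colourable pu uncoloured
  ... | no inner-e   = inner-colourable inner-e uncoloured λ d _ → ⊥-elim (healthy d)

  -- Colouring an inner edge never creates a defect; once no inner edge is left uncoloured there are none.
  healthy-move : ∀ {c : Colouring G 4} → Healthy c → HasUncoloured {G} c →
                 ∃ λ e → ∃ λ x → Legal {G} c e x × Healthy (update {G} c e x)
  healthy-move {c} healthy (e , uncoloured-e) with any? (λ s → uncoloured? {G} c s ×-dec ¬? (pendant? G s))
  ... | yes (s , uncoloured-s , inner-s) with x , legal ← healthy⇒colourable healthy uncoloured-s =
    s , x , legal , λ d → healthy (proj₂ (defect-update-inner inner-s d))
  ... | no all-inner-coloured with x , legal ← healthy⇒colourable healthy uncoloured-e =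
    e , x , legal , λ {_} {s} d →
      all-inner-coloured (s , proj₂ (uncoloured-update {G} {c = c} {e} {x} (uncoloured d)) , inner d)

  repair-move : ∀ {c : Colouring G 4} {r q s} x → Repairable c r → Defect c q s →
                StrategyInvariant (update {G} c s x) (afterMaker r)
  repair-move {r = zero} _ repairable d d′ with s′≢s , d″ ← defect-update-inner (inner d) d′ =
    s′≢s (proj₂ (repairable d″ d) refl)
  repair-move {r = suc _} _ repairable d d₁ d₂
    with s₁≢s , d₁′ ← defect-update-inner (inner d) d₁ | s₂≢s , d₂′ ← defect-update-inner (inner d) d₂
    with refl ← proj₁ (repairable d₁′ d) | refl ← proj₁ (repairable d₂′ d)
    = refl , λ _ → pendant-neighbours-besides G Δ≤3 (proj₂ (pendant d))
                     (adjacent d₁′) (adjacent d₂′) (adjacent d) s₁≢s s₂≢s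

  maker-move : ∀ {c : Colouring G 4} {r} → Repairable c r → HasUncoloured {G} c →
               ∃ λ e → ∃ λ x → Legal {G} c e x × StrategyInvariant (update {G} c e x) (afterMaker r)
  maker-move {c} {r} repairable some with defect? c
  ... | yes (_ , s , d) =
    let x , legal = inner-colourable (inner d) (uncoloured d) (λ d₁ d₂ → proj₁ (repairable d₁ d₂))
    in s , x , legal , repair-move x repairable d
  ... | no no-defect =
    let e , x , legal , healthy′ = healthy-move (λ d → no-defect (_ , _ , d)) some
    in e , x , legal , healthy⇒invariant healthy′ (afterMaker r)

  -- Breaker creates defects only around the edge he colours, and with m ≥ 2 Maker's turn has a second move.
  breaker-cannot-break : ∀ {m} → 2 ≤ m → ∀ {c : Colouring G 4} {e x} → Healthy c →
                         Repairable (update {G} c e x) (m ∸ 1)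
  breaker-cannot-break 2≤m {c} {e} {x} healthy d₁ d₂ =
    trans (at-e d₁) (sym (at-e d₂)) , λ m∸1≡0 → ⊥-elim (<⇒≱ 2≤m (m∸n≡0⇒m≤n m∸1≡0))
    where
    at-e : ∀ {q s} → Defect (update {G} c e x) q s → q ≡ e
    at-e d with defect-update d
    ... | _ , inj₁ q≡e = q≡e
    ... | _ , inj₂ d′  = ⊥-elim (healthy d′)

  empty-healthy : Healthy (emptyColouring {G} {4})
  empty-healthy d with () ← proj₂ (coloured d)

  maker-wins-with-four-colours : ∀ {m} → 2 ≤ m → MakerWinsGame G m 4
  maker-wins-with-four-colours {m} 2≤m = invariant⇒makerWins StrategyInvariant maker-move
    (λ healthy (e , uncoloured) → e , healthy⇒colourable healthy uncoloured)
    (λ {_} {e} {x} healthy _ → breaker-cannot-break 2≤m {e = e} {x} healthy)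
    (healthy⇒invariant empty-healthy (makerTurn (m ∸ 1)))

corollary3p2 : (T : Graph) (m : ℕ) → IsCaterpillar T → 2 ≤ m → MaxDegree T 3 →
    GameChromaticIndexAtMost T m 4
corollary3p2 T m caterpillar 2≤m (Δ≤3 , _) =
  4 , ≤-refl , maker-wins-with-four-colours Δ≤3 (caterpillar⇒innerClawFree T caterpillar) 2≤m
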